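{- $\mathrm{bet}(n)=\Theta(\log n)$ as $n\to\infty$. That is, there are constants $c_1,c_2>0$ and $n_0$ such that $c_1\log n\le \mathrm{bet}(n)\le c_2\log n$ for all $n\ge n_0$.
   Context: Let $n\ge 3$ and $[n]=\{1,\dots,n\}$. An ordering is a bijection $\phi:[n]\to[n]$; $\phi(x)$ is the position of $x$. A ternary constraint is a triple $(x_1,x_2,x_3)$ of distinct elements of $[n]$. An ordering $\phi$ between-satisfies $(x_1,x_2,x_3)$ if $\phi(x_1)<\phi(x_2)<\phi(x_3)$ or $\phi(x_3)<\phi(x_2)<\phi(x_1)$. An order-system is a set of orderings on $[n]$. It between-satisfies a constraint if at least one of its orderings does. $\mathrm{bet}(n)$ is the minimum size of an order-system on $[n]$ that between-satisfies every ternary constraint. -}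

module Defs where

open import Data.Nat using (ℕ; _<_)
open import Data.Fin as Fin using (Fin)
open import Data.Fin.Permutation using (Permutation′; _⟨$⟩ʳ_)
open import Data.Vec using (Vec)
open import Data.Vec.Relation.Unary.Any using (Any)
open import Data.Product using (_×_; Σ)
open import Data.Sum using (_⊎_)
open import Relation.Binary.PropositionalEquality using (_≢_)
open import Relation.Nullary using (¬_)

-- [n] is modelled by Fin n; an ordering is a bijection [n] → [n] (φ(x) = position of x).
Ordering : ℕ → Set
Ordering n = Permutation′ n

BetSat : ∀ {n} → Ordering n → Fin n → Fin n → Fin n → Set
BetSat φ x₁ x₂ x₃ =
  ((φ ⟨$⟩ʳ x₁) Fin.< (φ ⟨$⟩ʳ x₂) × (φ ⟨$⟩ʳ x₂) Fin.< (φ ⟨$⟩ʳ x₃))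
  ⊎ ((φ ⟨$⟩ʳ x₃) Fin.< (φ ⟨$⟩ʳ x₂) × (φ ⟨$⟩ʳ x₂) Fin.< (φ ⟨$⟩ʳ x₁))

OrderSystem : ℕ → ℕ → Set
OrderSystem n k = Vec (Ordering n) k

BetweenSatisfiesAll : ∀ {n k} → OrderSystem n k → Set
BetweenSatisfiesAll {n} S =
  (x₁ x₂ x₃ : Fin n) → x₁ ≢ x₂ → x₁ ≢ x₃ → x₂ ≢ x₃ →
  Any (λ φ → BetSat φ x₁ x₂ x₃) S

-- bet n ≡ k : k is the minimum size of an order-system on [n] between-satisfying
-- every ternary constraint.
IsBet : ℕ → ℕ → Set
IsBet n k =
  (Σ (OrderSystem n k) BetweenSatisfiesAll)
  × (∀ m → m < k → (S : OrderSystem n m) → ¬ BetweenSatisfiesAll S)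

module Submission where

-- Fix the element 0.  Record for every other
-- element x the vector of k bits "x precedes 0 in the t-th ordering".  If two
-- elements x ≠ z had the same vector, no ordering would put 0 between x and z,
-- so the constraint (x, 0, z) would fail.  Hence n - 1 ≤ 2^k.
--
-- If n ≤ 2^L, give every element its L binary
-- digits.  For every digit j take two orderings: digit-0 elements first, then
-- digit-1 elements, with the two blocks sorted (ascending, descending) resp.
-- (descending, ascending).  Any a, c differ in some digit j, and a case
-- analysis on the digit of b shows that one of these two orderings puts b
-- between a and c.  So 2L orderings suffice.
--
-- Finally,
-- the existence of a satisfying order-system of a given size is decidable (it
-- is a search over a finite set of codes), so the least size bet(n) exists and
-- is squeezed between the two bounds.

open import Defs
open import Data.Nat using (ℕ; zero; suc; _+_; _*_; _^_; _≤_; _<_; z≤n; s≤s; s<s)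
import Data.Nat as ℕ
import Data.Nat.Properties as ℕ
open import Data.Nat.Logarithm using (⌊log₂_⌋; ⌊log₂⌋-mono-≤; ⌊log₂[2^n]⌋≡n)
open import Data.Fin using (Fin; toℕ; fromℕ<; opposite; inject≤; punchOut; funToFin; finToFun)
  renaming (zero to fzero; suc to fsuc)
import Data.Fin as Fin
import Data.Fin.Properties as Fin
open import Data.Fin.Subset using (Subset; _∈_; ∣_∣)
open import Data.Fin.Subset.Properties using (∈⊤; ⊆⊤; ∣⊤∣≡n; p⊂q⇒∣p∣<∣q∣)
open import Data.Fin.Permutation using (permutation; _⟨$⟩ʳ_; _⟨$⟩ˡ_; inverseˡ)
open import Data.Vec using (tabulate; lookup; _++_)
open import Data.Vec.Properties using (lookup∘tabulate; lookup⇒[]=; []=⇒lookup)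
open import Data.Vec.Relation.Unary.Any using (index)
open import Data.Vec.Relation.Unary.Any.Properties using (tabulate⁺; lookup-index; ++⁺ˡ; ++⁺ʳ)
open import Data.Product using (Σ; ∃; _×_; _,_; proj₁; proj₂)
open import Data.Sum using (_⊎_; inj₁; inj₂)
import Data.Sum
open import Data.Bool using (true; false; if_then_else_)
open import Function using (_∘_; id)
open import Function.Definitions using (Injective)
open import Relation.Nullary using (¬_; Dec; yes; no; does; contradiction)
open import Relation.Nullary.Decidable
  using (map′; _×-dec_; _⊎-dec_; _→-dec_; ¬?; dec-true; dec-false; decidable-stable)
open import Relation.Binary.PropositionalEquality
  using (_≡_; _≢_; refl; sym; trans; cong; cong₂; subst; subst₂; module ≡-Reasoning)
open import Relation.Binary using (tri<; tri≈; tri>)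

private
  variable
    n m k : ℕ

-- An ordering φ
-- between-satisfies (a, b, c) exactly when this holds for the key "position
-- in φ": BetSat φ a b c is definitionally Between (position φ) a b c.
Between : {A : Set} → (A → ℕ) → A → A → A → Set
Between g a b c = (g a < g b × g b < g c) ⊎ (g c < g b × g b < g a)

position : Ordering n → Fin n → ℕ
position φ x = toℕ (φ ⟨$⟩ʳ x)

between? : {A : Set} (g : A → ℕ) (a b c : A) → Dec (Between g a b c)
between? g a b c =
  (g a ℕ.<? g b ×-dec g b ℕ.<? g c) ⊎-dec (g c ℕ.<? g b ×-dec g b ℕ.<? g a)

Between-flip : {A : Set} {g : A → ℕ} {a b c : A} → Between g a b c → Between g c b a
Between-flip (inj₁ (p , q)) = inj₂ (p , q)
Between-flip (inj₂ (p , q)) = inj₁ (p , q)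

Between-mono : {A : Set} {g h : A → ℕ} → (∀ {x y} → g x < g y → h x < h y) →
               {a b c : A} → Between g a b c → Between h a b c
Between-mono mono (inj₁ (p , q)) = inj₁ (mono p , mono q)
Between-mono mono (inj₂ (p , q)) = inj₂ (mono p , mono q)

position-injective : (φ : Ordering n) → Injective _≡_ _≡_ (φ ⟨$⟩ʳ_)
position-injective φ e = trans (sym (inverseˡ φ)) (trans (cong (φ ⟨$⟩ˡ_) e) (inverseˡ φ))

-- An injective endomap of Fin n is surjective: a missed value would let us
-- squeeze Fin (suc n) injectively into Fin n.
injective⇒surjective : {f : Fin n → Fin n} → Injective _≡_ _≡_ f → ∀ y → ∃ λ x → f x ≡ y
injective⇒surjective {suc n} {f} f-inj y with Fin.any? (λ x → f x Fin.≟ y)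
... | yes hit = hit
... | no miss = contradiction (Fin.injective⇒≤ squeeze-injective) ℕ.1+n≰n
  where
  misses : ∀ x → y ≢ f x
  misses x e = miss (x , sym e)
  squeeze : Fin (suc n) → Fin n
  squeeze x = punchOut (misses x)
  squeeze-injective : Injective _≡_ _≡_ squeeze
  squeeze-injective {x} {z} e = f-inj (Fin.punchOut-injective (misses x) (misses z) e)

fromInjection : {f : Fin n → Fin n} → Injective _≡_ _≡_ f → Ordering n
fromInjection {f = f} f-inj = permutation f (λ y → proj₁ (onto y)) (λ y → proj₂ (onto y))
  (λ x → f-inj (proj₂ (onto (f x))))
  where
  onto : ∀ y → ∃ λ x → f x ≡ y
  onto = injective⇒surjective f-inj

module Rank (g : Fin n → ℕ) where

  below : ℕ → Subset n
  below v = tabulate (λ y → does (g y ℕ.<? v))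

  ∈below⁺ : ∀ {y v} → g y < v → y ∈ below v
  ∈below⁺ {y} {v} lt =
    lookup⇒[]= y _ (trans (lookup∘tabulate _ y) (dec-true (g y ℕ.<? v) lt))

  ∈below⁻ : ∀ {y v} → y ∈ below v → g y < v
  ∈below⁻ {y} {v} y∈ = decidable-stable (g y ℕ.<? v) λ ¬lt →
    false≢true (trans (sym (dec-false (g y ℕ.<? v) ¬lt)) inside)
    where
    false≢true : false ≢ true
    false≢true ()
    inside : does (g y ℕ.<? v) ≡ true
    inside = trans (sym (lookup∘tabulate _ y)) ([]=⇒lookup y∈)

  rank : Fin n → ℕ
  rank x = ∣ below (g x) ∣

  -- x itself is not counted, so its rank is a valid position.
  rank<n : ∀ x → rank x < n
  rank<n x = subst (rank x <_) (∣⊤∣≡n n)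
    (p⊂q⇒∣p∣<∣q∣ (⊆⊤ , x , ∈⊤ , λ x∈ → ℕ.<-irrefl refl (∈below⁻ x∈)))

  -- A larger key counts strictly more elements (x itself, at least).
  rank-mono : ∀ {x y} → g x < g y → rank x < rank y
  rank-mono {x} {y} lt =
    p⊂q⇒∣p∣<∣q∣ ((λ z∈ → ∈below⁺ (ℕ.<-trans (∈below⁻ z∈) lt)) ,
                 x , ∈below⁺ lt , λ x∈ → ℕ.<-irrefl refl (∈below⁻ x∈))

  rankFin : Fin n → Fin n
  rankFin x = fromℕ< (rank<n x)

  rankFin-mono : ∀ {x y} → g x < g y → toℕ (rankFin x) < toℕ (rankFin y)
  rankFin-mono {x} {y} lt =
    subst₂ _<_ (sym (Fin.toℕ-fromℕ< (rank<n x))) (sym (Fin.toℕ-fromℕ< (rank<n y))) (rank-mono lt)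

module _ (g : Fin n → ℕ) (g-inj : Injective _≡_ _≡_ g) where
  open Rank g

  rankFin-injective : Injective _≡_ _≡_ rankFin
  rankFin-injective {x} {y} e with ℕ.<-cmp (g x) (g y)
  ... | tri< lt _ _ = contradiction (cong toℕ e) (ℕ.<⇒≢ (rankFin-mono lt))
  ... | tri≈ _ eq _ = g-inj eq
  ... | tri> _ _ gt = contradiction (cong toℕ e) (ℕ.>⇒≢ (rankFin-mono gt))

  keyOrdering : Ordering n
  keyOrdering = fromInjection rankFin-injective

  keyOrdering-between : ∀ {a b c} → Between g a b c → BetSat keyOrdering a b c
  keyOrdering-between = Between-mono (λ {x} {y} → rankFin-mono {x} {y})

place : (h₀ h₁ : Fin n → Fin n) → Fin 2 → Fin n → ℕ
place h₀ h₁ fzero x = toℕ (h₀ x)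
place {n} h₀ h₁ (fsuc _) x = n + toℕ (h₁ x)

module TwoBlocks (β : Fin n → Fin 2) (h₀ h₁ : Fin n → Fin n) where

  key : Fin n → ℕ
  key x = place h₀ h₁ (β x) x

  block₀<block₁ : ∀ x y → toℕ (h₀ x) < n + toℕ (h₁ y)
  block₀<block₁ x y = ℕ.<-≤-trans (Fin.toℕ<n (h₀ x)) (ℕ.m≤m+n n _)

  cross : ∀ {x y i} → β x ≡ fzero → β y ≡ fsuc i → key x < key y
  cross {x} {y} ex ey rewrite ex | ey = block₀<block₁ x y

  within₀ : ∀ {x y} → β x ≡ fzero → β y ≡ fzero → h₀ x Fin.< h₀ y → key x < key y
  within₀ ex ey lt rewrite ex | ey = lt

  within₁ : ∀ {x y i j} → β x ≡ fsuc i → β y ≡ fsuc j → h₁ x Fin.< h₁ y → key x < key y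
  within₁ ex ey lt rewrite ex | ey = ℕ.+-monoʳ-< n lt

  key-injective : Injective _≡_ _≡_ h₀ → Injective _≡_ _≡_ h₁ → Injective _≡_ _≡_ key
  key-injective h₀-inj h₁-inj {x} {y} e with β x | β y
  ... | fzero  | fzero  = h₀-inj (Fin.toℕ-injective e)
  ... | fsuc _ | fsuc _ = h₁-inj (Fin.toℕ-injective (ℕ.+-cancelˡ-≡ n _ _ e))
  ... | fzero  | fsuc _ = contradiction e (ℕ.<⇒≢ (block₀<block₁ x y))
  ... | fsuc _ | fzero  = contradiction e (ℕ.>⇒≢ (block₀<block₁ y x))

opposite-injective : Injective _≡_ _≡_ (opposite {n})
opposite-injective {x = x} {y} e =
  trans (sym (Fin.opposite-involutive x)) (trans (cong opposite e) (Fin.opposite-involutive y))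

opposite-antitone : {x y : Fin n} → x Fin.< y → opposite y Fin.< opposite x
opposite-antitone {n} {x} {y} lt =
  subst₂ _<_ (sym (Fin.opposite-prop y)) (sym (Fin.opposite-prop x))
    (ℕ.∸-monoʳ-< (s<s lt) (Fin.toℕ<n y))

module Colouring (β : Fin n → Fin 2) where
  module AscDesc = TwoBlocks β id opposite
  module DescAsc = TwoBlocks β opposite id

  ascDesc-injective : Injective _≡_ _≡_ AscDesc.key
  ascDesc-injective = AscDesc.key-injective id opposite-injective

  descAsc-injective : Injective _≡_ _≡_ DescAsc.key
  descAsc-injective = DescAsc.key-injective opposite-injective id

  ascDesc descAsc : Ordering n
  ascDesc = keyOrdering AscDesc.key ascDesc-injective
  descAsc = keyOrdering DescAsc.key descAsc-injective

  -- If a has colour 0 and c colour 1, one of the two orderings puts any third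
  -- element b between them: compare b with the endpoint of its own colour.
  split : ∀ {a b c i} → β a ≡ fzero → β c ≡ fsuc i → b ≢ a → b ≢ c →
          Between AscDesc.key a b c ⊎ Between DescAsc.key a b c
  split {a} {b} {c} ea ec b≢a b≢c = byColourOf-b (β b) refl
    where
    byColourOf-b : ∀ colour → β b ≡ colour →
                   Between AscDesc.key a b c ⊎ Between DescAsc.key a b c
    byColourOf-b fzero eb with Fin.<-cmp a b
    ... | tri< a<b _ _ = inj₁ (inj₁ (AscDesc.within₀ ea eb a<b , AscDesc.cross eb ec))
    ... | tri≈ _ a≡b _ = contradiction (sym a≡b) b≢a
    ... | tri> _ _ b<a =
          inj₂ (inj₁ (DescAsc.within₀ ea eb (opposite-antitone b<a) , DescAsc.cross eb ec))
    byColourOf-b (fsuc _) eb with Fin.<-cmp b c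
    ... | tri< b<c _ _ = inj₂ (inj₁ (DescAsc.cross ea eb , DescAsc.within₁ eb ec b<c))
    ... | tri≈ _ b≡c _ = contradiction b≡c b≢c
    ... | tri> _ _ c<b =
          inj₁ (inj₁ (AscDesc.cross ea eb , AscDesc.within₁ eb ec (opposite-antitone c<b)))

  ascDesc-between : ∀ {a b c} → Between AscDesc.key a b c → BetSat ascDesc a b c
  ascDesc-between = keyOrdering-between AscDesc.key ascDesc-injective

  descAsc-between : ∀ {a b c} → Between DescAsc.key a b c → BetSat descAsc a b c
  descAsc-between = keyOrdering-between DescAsc.key descAsc-injective

  separates : ∀ {a b c} → β a ≢ β c → b ≢ a → b ≢ c →
              BetSat ascDesc a b c ⊎ BetSat descAsc a b c
  separates {a} {b} {c} β≢ b≢a b≢c = byColours (β a) (β c) refl refl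
    where
    byColours : ∀ colour-a colour-c → β a ≡ colour-a → β c ≡ colour-c →
                BetSat ascDesc a b c ⊎ BetSat descAsc a b c
    byColours fzero (fsuc _) ea ec =
      Data.Sum.map ascDesc-between descAsc-between (split ea ec b≢a b≢c)
    byColours (fsuc _) fzero ea ec =
      Data.Sum.map (ascDesc-between ∘ Between-flip {g = AscDesc.key})
                   (descAsc-between ∘ Between-flip {g = DescAsc.key})
        (split ec ea b≢c b≢a)
    byColours fzero fzero ea ec = contradiction (trans ea (sym ec)) β≢
    byColours (fsuc fzero) (fsuc fzero) ea ec = contradiction (trans ea (sym ec)) β≢

funToFin-cong : {f g : Fin m → Fin k} → (∀ i → f i ≡ g i) → funToFin f ≡ funToFin g
funToFin-cong {zero} same = refl
funToFin-cong {suc m} same = cong₂ Fin.combine (same fzero) (funToFin-cong (same ∘ fsuc))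

digits-separate : ∀ {b} L {x z : Fin (b ^ L)} → x ≢ z → ∃ λ j → finToFun x j ≢ finToFun z j
digits-separate {b} L {x} {z} x≢z =
  Fin.¬∀⟶∃¬ L _ (λ j → finToFun x j Fin.≟ finToFun z j) λ same → x≢z (begin
    x                           ≡⟨ Fin.funToFin-finToFin {L} {b} x ⟨
    funToFin {L} (finToFun x)  ≡⟨ funToFin-cong same ⟩
    funToFin {L} (finToFun z)  ≡⟨ Fin.funToFin-finToFin {L} {b} z ⟩
    z                           ∎)
  where open ≡-Reasoning

module DigitSystem (L : ℕ) (n≤2^L : n ≤ 2 ^ L) where

  digit : Fin L → Fin n → Fin 2
  digit j x = finToFun (inject≤ x n≤2^L) j

  system : OrderSystem n (L + L)
  system = tabulate (Colouring.ascDesc ∘ digit) ++ tabulate (Colouring.descAsc ∘ digit)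

  satisfies : BetweenSatisfiesAll system
  satisfies a b c a≢b a≢c b≢c =
    let j , differ = digits-separate L (a≢c ∘ Fin.inject≤-injective _ _ a c)
    in Data.Sum.[ ++⁺ˡ ∘ tabulate⁺ j , ++⁺ʳ _ ∘ tabulate⁺ j ]′
         (Colouring.separates (digit j) differ (a≢b ∘ sym) b≢c)

side : {A : Set} → (A → ℕ) → A → A → Fin 2
side g p x = if does (g x ℕ.<? g p) then fsuc fzero else fzero

between⇒sides-differ : {A : Set} {g : A → ℕ} {x p z : A} →
                       Between g x p z → side g p x ≢ side g p z
between⇒sides-differ {g = g} {x} {p} {z} (inj₁ (x<p , p<z))
  rewrite dec-true (g x ℕ.<? g p) x<p | dec-false (g z ℕ.<? g p) (ℕ.<-asym p<z) = λ ()
between⇒sides-differ {g = g} {x} {p} {z} (inj₂ (z<p , p<x))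
  rewrite dec-true (g z ℕ.<? g p) z<p | dec-false (g x ℕ.<? g p) (ℕ.<-asym p<x) = λ ()

-- Otherwise two non-pivot elements x ≠ z would have the same sides
-- (relative to the pivot 0) in every ordering, and (x, 0, z) would fail.
pivot-bound : (S : OrderSystem (suc n) k) → BetweenSatisfiesAll S → n ≤ 2 ^ k
pivot-bound {n} {k} S sat = ℕ.≮⇒≥ λ 2^k<n →
  let x , z , x<z , same = Fin.pigeonhole 2^k<n signature
      hit = sat (fsuc x) fzero (fsuc z) (λ ()) (Fin.<⇒≢ x<z ∘ Fin.suc-injective) (λ ())
      t = index hit
  in between⇒sides-differ {g = position (lookup S t)} (lookup-index hit) (sameSides same t)
  where
  sides : Fin n → Fin k → Fin 2
  sides x t = side (position (lookup S t)) fzero (fsuc x)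

  signature : Fin n → Fin (2 ^ k)
  signature x = funToFin (sides x)

  sameSides : ∀ {x z} → signature x ≡ signature z → ∀ t → sides x t ≡ sides z t
  sameSides {x} {z} same t = begin
    sides x t                       ≡⟨ Fin.finToFun-funToFin (sides x) t ⟨
    finToFun (signature x) t        ≡⟨ cong (λ s → finToFun s t) same ⟩
    finToFun (signature z) t        ≡⟨ Fin.finToFun-funToFin (sides z) t ⟩
    sides z t                       ∎
    where open ≡-Reasoning

Satisfying : ℕ → ℕ → Set
Satisfying n k = Σ (OrderSystem n k) BetweenSatisfiesAll

-- The same data with each ordering replaced by its position map: k injective
-- maps Fin n → Fin n whose position keys satisfy every constraint.  Unlike
-- permutation records, such families range over a finite set.
Valid : (Fin k → Fin n → Fin n) → Set
Valid {k} {n} F =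
  (∀ i x y → F i x ≡ F i y → x ≡ y) ×
  (∀ a b c → a ≢ b → a ≢ c → b ≢ c → ∃ λ i → Between (toℕ ∘ F i) a b c)

valid? : (F : Fin k → Fin n → Fin n) → Dec (Valid F)
valid? F =
  Fin.all? (λ i → Fin.all? λ x → Fin.all? λ y → (F i x Fin.≟ F i y) →-dec (x Fin.≟ y))
  ×-dec
  Fin.all? (λ a → Fin.all? λ b → Fin.all? λ c →
    ¬? (a Fin.≟ b) →-dec (¬? (a Fin.≟ c) →-dec (¬? (b Fin.≟ c) →-dec
      Fin.any? (λ i → between? (toℕ ∘ F i) a b c))))

decode : Fin ((n ^ n) ^ k) → Fin k → Fin n → Fin n
decode code i = finToFun (finToFun code i)

encode : (Fin k → Fin n → Fin n) → Fin ((n ^ n) ^ k)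
encode F = funToFin (λ i → funToFin (F i))

decode-encode : (F : Fin k → Fin n → Fin n) → ∀ i x → decode (encode F) i x ≡ F i x
decode-encode F i x = begin
  finToFun (finToFun (encode F) i) x  ≡⟨ cong (λ f → finToFun f x) (Fin.finToFun-funToFin _ i) ⟩
  finToFun (funToFin (F i)) x         ≡⟨ Fin.finToFun-funToFin (F i) x ⟩
  F i x                               ∎
  where open ≡-Reasoning

satisfying⇒code : Satisfying n k → ∃ λ code → Valid (decode {n} {k} code)
satisfying⇒code {n} {k} (S , sat) = encode F , injective , satisfies
  where
  F : Fin k → Fin n → Fin n
  F i x = lookup S i ⟨$⟩ʳ x

  same : ∀ i {x} → toℕ (F i x) ≡ toℕ (decode (encode F) i x)
  same i {x} = cong toℕ (sym (decode-encode F i x))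

  injective : ∀ i x y → decode (encode F) i x ≡ decode (encode F) i y → x ≡ y
  injective i x y e = position-injective (lookup S i)
    (trans (sym (decode-encode F i x)) (trans e (decode-encode F i y)))

  satisfies : ∀ a b c → a ≢ b → a ≢ c → b ≢ c →
              ∃ λ i → Between (toℕ ∘ decode (encode F) i) a b c
  satisfies a b c a≢b a≢c b≢c =
    let hit = sat a b c a≢b a≢c b≢c
        i = index hit
    in i , Between-mono (λ {x} {y} → subst₂ _<_ (same i {x}) (same i {y})) (lookup-index hit)

code⇒satisfying : ∃ (λ code → Valid (decode {n} {k} code)) → Satisfying n k
code⇒satisfying (code , injective , satisfies) =
  tabulate (λ i → fromInjection (injective i _ _)) ,
  λ a b c a≢b a≢c b≢c → let i , between = satisfies a b c a≢b a≢c b≢c in tabulate⁺ i between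

satisfying? : ∀ n k → Dec (Satisfying n k)
satisfying? n k = map′ code⇒satisfying satisfying⇒code
  (Fin.any? (valid? ∘ decode))

least-upto : {P : ℕ → Set} → (∀ k → Dec (P k)) → ∀ u →
             (∃ λ k → P k × k ≤ u × (∀ m → m < k → ¬ P m)) ⊎ (∀ m → m ≤ u → ¬ P m)
least-upto P? zero with P? zero
... | yes p = inj₁ (zero , p , z≤n , λ m ())
... | no ¬p = inj₂ λ { .zero z≤n → ¬p }
least-upto P? (suc u) with least-upto P? u
... | inj₁ (k , p , k≤u , minimal) = inj₁ (k , p , ℕ.m≤n⇒m≤1+n k≤u , minimal)
... | inj₂ none with P? (suc u)
...   | yes p = inj₁ (suc u , p , ℕ.≤-refl , λ m m<1+u → none m (ℕ.s≤s⁻¹ m<1+u))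
...   | no ¬p = inj₂ λ m m≤1+u →
          Data.Sum.[ none m ∘ ℕ.s≤s⁻¹ , (λ { refl → ¬p }) ]′ (ℕ.m≤n⇒m<n∨m≡n m≤1+u)

bet-exists : ∀ {u} → Satisfying n u → ∃ λ k → IsBet n k × k ≤ u
bet-exists {n} {u} satisfying with least-upto (satisfying? n) u
... | inj₁ (k , least , k≤u , minimal) =
      k , (least , λ m m<k S sat → minimal m m<k (S , sat)) , k≤u
... | inj₂ none = contradiction satisfying (none u ℕ.≤-refl)

double : ∀ m → 2 * m ≡ m + m
double m = cong (m +_) (ℕ.+-identityʳ m)

1+m≤2m : 1 ≤ m → suc m ≤ 2 * m
1+m≤2m {m} 1≤m = subst (suc m ≤_) (sym (double m)) (ℕ.+-monoˡ-≤ m 1≤m)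

n<2^[1+⌊log₂n⌋] : ∀ n → n < 2 ^ suc ⌊log₂ n ⌋
n<2^[1+⌊log₂n⌋] n = ℕ.≰⇒> λ 2^≤n →
  ℕ.1+n≰n (subst (_≤ ⌊log₂ n ⌋) (⌊log₂[2^n]⌋≡n _) (⌊log₂⌋-mono-≤ 2^≤n))

log-lower : ∀ {n k} → 2 ≤ n → n ≤ 2 ^ k → ⌊log₂ (suc n) ⌋ ≤ 2 * k
log-lower {n} {zero} 2≤n n≤1 with ℕ.≤-trans 2≤n n≤1
... | s≤s ()
log-lower {n} {suc k} _ n≤2^k = begin
  ⌊log₂ (suc n) ⌋          ≤⟨ ⌊log₂⌋-mono-≤ 1+n≤2^[2+k] ⟩
  ⌊log₂ (2 ^ suc (suc k)) ⌋ ≡⟨ ⌊log₂[2^n]⌋≡n (suc (suc k)) ⟩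
  suc (suc k)              ≤⟨ 1+m≤2m (s≤s z≤n) ⟩
  2 * suc k                ∎
  where
  open ℕ.≤-Reasoning
  1+n≤2^[2+k] : suc n ≤ 2 ^ suc (suc k)
  1+n≤2^[2+k] = ℕ.≤-trans (ℕ.+-mono-≤ (ℕ.m^n>0 2 (suc k)) n≤2^k)
                          (ℕ.≤-reflexive (sym (double (2 ^ suc k))))

size-upper : ∀ {l} → 1 ≤ l → suc l + suc l ≤ 4 * l
size-upper {l} 1≤l = begin
  suc l + suc l  ≡⟨ double (suc l) ⟨
  2 * suc l      ≤⟨ ℕ.*-monoʳ-≤ 2 (1+m≤2m 1≤l) ⟩
  2 * (2 * l)    ≡⟨ ℕ.*-assoc 2 2 l ⟨
  4 * l          ∎
  where open ℕ.≤-Reasoning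

theorem1p6 : Σ ℕ λ d → Σ ℕ λ c → Σ ℕ λ n₀ →
    ∀ n → n₀ ≤ n → ∃ λ k → IsBet n k × (⌊log₂ n ⌋ ≤ d * k) × (k ≤ c * ⌊log₂ n ⌋)
theorem1p6 = 2 , 4 , 3 , bounds
  where
  bounds : ∀ n → 3 ≤ n → ∃ λ k → IsBet n k × (⌊log₂ n ⌋ ≤ 2 * k) × (k ≤ 4 * ⌊log₂ n ⌋)
  bounds (suc n) (s≤s 2≤n) =
    let l = ⌊log₂ (suc n) ⌋
        n<2^[1+l] = n<2^[1+⌊log₂n⌋] (suc n)
        open DigitSystem (suc l) (ℕ.<⇒≤ n<2^[1+l])
        k , isBet@((S , sat) , _) , k≤2[1+l] = bet-exists (system , satisfies)
        1≤l = ⌊log₂⌋-mono-≤ {2} (ℕ.m≤n⇒m≤1+n 2≤n)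
    in k , isBet , log-lower {k = k} 2≤n (pivot-bound S sat) ,
       ℕ.≤-trans k≤2[1+l] (size-upper 1≤l)
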